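{- Let $G_1,\ldots,G_m$ be finite connected graphs, let $G$ be a subgraph (with at least one vertex) of the Cartesian product $G_1\square\cdots\square G_m$, and let $\beta:=\lceil\max\{\mathrm{mad}(G_1),\ldots,\mathrm{mad}(G_m)\}\rceil$ and $\beta_0:=\lceil\max\{\mathrm{mad}(\pi_1(G)),\ldots,\mathrm{mad}(\pi_m(G))\}\rceil$. Then $$\frac{|E(G)|}{|V(G)|}\le \beta_0\log|V(G)|\le \beta\log|V(G)|.$$
   Context: All graphs are finite, simple and undirected; $\log$ denotes the logarithm in base 2. The Cartesian product $G_1\square\cdots\square G_m$ has vertex set $V(G_1)\times\cdots\times V(G_m)$, two tuples $x,y$ being adjacent iff there is an index $j$ with $x_jy_j\in E(G_j)$ and $x_i=y_i$ for all $i\neq j$. For a graph $F$, $\mathrm{mad}(F)$ is the maximum of $2|E(F')|/|V(F')|$ over all subgraphs $F'$ of $F$. For a subgraph $G$ of the product, $\pi_i(G)$ denotes the subgraph of $G_i$ induced by the set $\{x_i : (x_1,\ldots,x_m)\in V(G)\}$ of $i$-th coordinates of vertices of $G$. -}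

module Defs where

open import Data.Nat using (ℕ; zero; suc; _+_; _*_; _≤_; _<ᵇ_)
open import Data.Fin using (Fin; toℕ)
open import Data.Bool using (Bool; true; false; _∧_; if_then_else_)
open import Data.List using (List; map; allFin)
open import Data.Nat.ListAction using (sum)
open import Data.Product using (Σ; _×_; ∃)
open import Data.Unit using (⊤)
open import Relation.Binary.PropositionalEquality using (_≡_; _≢_)

record Graph : Set where
  field
    n      : ℕ
    adj    : Fin n → Fin n → Bool
    sym    : ∀ u v → adj u v ≡ adj v u
    irrefl : ∀ u → adj u u ≡ false
open Graph public

∣V∣ : Graph → ℕ
∣V∣ F = n F

∣E∣ : Graph → ℕ
∣E∣ F = sum (map (λ u → sum (map (λ v → if (adj F u v ∧ (toℕ u <ᵇ toℕ v)) then 1 else 0)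
                                  (allFin (n F))))
                 (allFin (n F)))

data Reach (F : Graph) : Fin (n F) → Fin (n F) → Set where
  here : ∀ {u} → Reach F u u
  step : ∀ {u v w} → adj F u v ≡ true → Reach F v w → Reach F u w

Connected : Graph → Set
Connected F = ∀ u v → Reach F u v

-- With S = everything this is "H is a subgraph of F"; with S a vertex set,
-- these are exactly the subgraphs of the induced subgraph F[S].
SubgraphIn : (H F : Graph) → (Fin (n F) → Set) → Set
SubgraphIn H F S =
  Σ (Fin (n H) → Fin (n F)) λ f →
    (∀ u v → f u ≡ f v → u ≡ v) ×
    (∀ u v → adj H u v ≡ true → adj F (f u) (f v) ≡ true) ×
    (∀ u → S (f u))

-- mad(F[S]) ≤ k : every subgraph H of F[S] has 2|E(H)|/|V(H)| ≤ k
-- (written multiplicatively; empty subgraphs satisfy it trivially).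
MadAtMost : (F : Graph) → (Fin (n F) → Set) → ℕ → Set
MadAtMost F S k = ∀ (H : Graph) → SubgraphIn H F S → 2 * ∣E∣ H ≤ k * ∣V∣ H

-- k = ⌈ max_i mad(F_i[S_i]) ⌉ : the least natural number k with
-- max_i mad(F_i[S_i]) ≤ k.
IsCeilMaxMad : ∀ {m} (F : Fin m → Graph) → ((i : Fin m) → Fin (n (F i)) → Set) → ℕ → Set
IsCeilMaxMad F S k =
  (∀ i → MadAtMost (F i) (S i) k) ×
  (∀ k' → (∀ i → MadAtMost (F i) (S i) k') → k ≤ k')

ProdV : ∀ {m} → (Fin m → Graph) → Set
ProdV {m} Gs = (i : Fin m) → Fin (n (Gs i))

ProdAdj : ∀ {m} (Gs : Fin m → Graph) → ProdV Gs → ProdV Gs → Set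
ProdAdj {m} Gs x y =
  Σ (Fin m) λ j → (adj (Gs j) (x j) (y j) ≡ true) × (∀ i → i ≢ j → x i ≡ y i)

IsProdSubgraph : ∀ {m} (Gs : Fin m → Graph) (G : Graph) → (Fin (n G) → ProdV Gs) → Set
IsProdSubgraph Gs G φ =
  (∀ u v → (∀ i → φ u i ≡ φ v i) → u ≡ v) ×
  (∀ u v → adj G u v ≡ true → ProdAdj Gs (φ u) (φ v))

ProjSet : ∀ {m} (Gs : Fin m → Graph) (G : Graph) → (Fin (n G) → ProdV Gs) →
          (i : Fin m) → Fin (n (Gs i)) → Set
ProjSet Gs G φ i a = ∃ λ v → φ v i ≡ a

AllV : ∀ {m} (Gs : Fin m → Graph) → (i : Fin m) → Fin (n (Gs i)) → Set
AllV Gs i a = ⊤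

module Submission where

-- For S ⊆ V(G) let e₂(S) count ordered adjacent pairs in S. We show
-- e₂(S) ≤ 2β₀·|S|·log|S| by strong induction on |S|. If all members of S
-- have the same coordinates, S has at most one vertex. Otherwise some
-- coordinate i takes two values on S; the projection π_i(S) lies in π_i(G),
-- whose mad is ≤ β₀, so some a ∈ π_i(S) has at most β₀ neighbours in π_i(S).
-- Split S into the fibre {φ_i = a} and the rest. An edge between the parts
-- changes only coordinate i, so a fibre vertex has ≤ β₀ neighbours in the rest
-- and a rest vertex has ≤ 1 neighbour in the fibre; the crossing edges number
-- at most β₀·min(|fibre|, |rest|), and k log k + l log l + min(k, l) ≤
-- (k+l) log(k+l) closes the induction.

open import Defs hiding (sym)
open import Data.Nat using (ℕ; zero; suc; _+_; _*_; _^_; _≤_; _<_; z≤n; s≤s; _<ᵇ_; >-nonZero)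
open import Data.Nat.Properties hiding (_≟_; suc-injective)
open import Data.Fin using (Fin; zero; suc; toℕ; _≟_)
open import Data.Fin.Properties using (suc-injective; toℕ-injective; any?)
open import Data.Bool using (Bool; true; false; _∧_; not; if_then_else_)
import Data.Bool as Bool
open import Data.Bool.Properties using (∧-zeroʳ; ∧-identityʳ)
open import Data.List using (map; allFin; tabulate)
open import Data.List.Properties using (map-tabulate)
import Data.Nat.ListAction as List
open import Data.Product using (_×_; _,_; proj₁; proj₂; ∃; map₂)
open import Data.Sum using (inj₁; inj₂)
open import Relation.Nullary using (Dec; yes; no; does; ¬_; contradiction; _×-dec_; ¬?)
open import Function using (case_of_)
open import Relation.Nullary.Decidable using (dec-true; dec-false; decidable-stable)
open import Data.Nat.Tactic.RingSolver using (solve-∀)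
open import Data.Nat.Induction using (<-wellFounded)
open import Induction.WellFounded using (module All)
import Relation.Binary.Construct.On as On
open import Relation.Binary.PropositionalEquality hiding ([_])
open import Algebra.Properties.Semiring.Sum +-*-semiring
  using (sum; sum-cong-≗; ∑-distrib-+; ∑-comm; *-distribˡ-sum; sum-replicate-zero)
open import Algebra.Properties.CommutativeSemigroup *-commutativeSemigroup using (x∙yz≈y∙xz)

sum-mono : ∀ {k} {f g : Fin k → ℕ} → (∀ i → f i ≤ g i) → sum f ≤ sum g
sum-mono {zero}  f≤g = z≤n
sum-mono {suc k} f≤g = +-mono-≤ (f≤g zero) (sum-mono (λ i → f≤g (suc i)))

term≤sum : ∀ {k} (f : Fin k → ℕ) (i : Fin k) → f i ≤ sum f
term≤sum f zero    = m≤m+n _ _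
term≤sum f (suc i) = ≤-trans (term≤sum (λ j → f (suc j)) i) (m≤n+m _ _)

sum-const1 : ∀ k → sum {k} (λ _ → 1) ≡ k
sum-const1 zero    = refl
sum-const1 (suc k) = cong suc (sum-const1 k)

listSum-allFin : ∀ {k} (f : Fin k → ℕ) → List.sum (map f (allFin k)) ≡ sum f
listSum-allFin {k} f = trans (cong List.sum (map-tabulate (λ i → i) f)) (tabulated f)
  where
  tabulated : ∀ {j} (g : Fin j → ℕ) → List.sum (tabulate g) ≡ sum g
  tabulated {zero}  g = refl
  tabulated {suc j} g = cong (g zero +_) (tabulated (λ i → g (suc i)))

ind : Bool → ℕ
ind b = if b then 1 else 0

ind-∧ : ∀ a b → ind (a ∧ b) ≡ ind a * ind b
ind-∧ false b     = refl
ind-∧ true  false = refl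
ind-∧ true  true  = refl

ind-split : ∀ a c → ind a ≡ ind (a ∧ c) + ind (a ∧ not c)
ind-split false c     = refl
ind-split true  false = refl
ind-split true  true  = refl

∧-true : ∀ a b → (a ∧ b) ≡ true → a ≡ true × b ≡ true
∧-true true true _ = refl , refl

from-does : ∀ {P : Set} (P? : Dec P) → does P? ≡ true → P
from-does (yes p) _ = p

from-not-does : ∀ {P : Set} (P? : Dec P) → not (does P?) ≡ true → ¬ P
from-not-does (no ¬p) _ = ¬p

𝟙 : ∀ {k} → (Fin k → Bool) → Fin k → ℕ
𝟙 p b = ind (p b)

count : ∀ {k} → (Fin k → Bool) → ℕ
count p = sum (𝟙 p)

member≤count : ∀ {k} (p : Fin k → Bool) b → p b ≡ true → 1 ≤ count p
member≤count p b pb = subst (λ x → ind x ≤ count p) pb (term≤sum (𝟙 p) b)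

_∖_ : ∀ {k} → (Fin k → Bool) → Fin k → (Fin k → Bool)
(q ∖ b) c = q c ∧ not (does (c ≟ b))

count-∖ : ∀ {k} (q : Fin k → Bool) b → count q ≡ ind (q b) + count (q ∖ b)
count-∖ {suc k} q zero = cong (ind (q zero) +_) (cong₂ _+_
  (cong ind (sym (∧-zeroʳ (q zero)))) (sum-cong-≗ (λ c → cong ind (sym (∧-identityʳ (q (suc c)))))))
count-∖ {suc k} q (suc b) = begin
    ind (q zero) + count (λ c → q (suc c))
  ≡⟨ cong (ind (q zero) +_) (count-∖ (λ c → q (suc c)) b) ⟩
    ind (q zero) + (ind (q (suc b)) + count (λ c → (q ∖ suc b) (suc c)))
  ≡⟨ +-comm-middle (ind (q zero)) (ind (q (suc b))) _ ⟩
    ind (q (suc b)) + (ind (q zero) + count (λ c → (q ∖ suc b) (suc c)))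
  ≡⟨ cong (λ x → ind (q (suc b)) + (ind x + count (λ c → (q ∖ suc b) (suc c))))
          (sym (∧-identityʳ (q zero))) ⟩
    ind (q (suc b)) + count (q ∖ suc b) ∎
  where
  open ≡-Reasoning
  +-comm-middle : ∀ x y z → x + (y + z) ≡ y + (x + z)
  +-comm-middle x y z = trans (sym (+-assoc x y z)) (trans (cong (_+ z) (+-comm x y)) (+-assoc y x z))

count-inj : ∀ {k l} (p : Fin k → Bool) (q : Fin l → Bool) (f : Fin k → Fin l) →
  (∀ v → p v ≡ true → q (f v) ≡ true) →
  (∀ v w → p v ≡ true → p w ≡ true → f v ≡ f w → v ≡ w) →
  count p ≤ count q
count-inj {zero} p q f into inj = z≤n
count-inj {suc k} p q f into inj with p zero in p0
... | false = count-inj (λ v → p (suc v)) q (λ v → f (suc v)) (λ v → into (suc v))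
                (λ v w pv pw e → suc-injective (inj (suc v) (suc w) pv pw e))
... | true rewrite count-∖ q (f zero) | into zero p0 =
  s≤s (count-inj (λ v → p (suc v)) (q ∖ f zero) (λ v → f (suc v)) into′
         (λ v w pv pw e → suc-injective (inj (suc v) (suc w) pv pw e)))
  where
  into′ : ∀ v → p (suc v) ≡ true → (q ∖ f zero) (f (suc v)) ≡ true
  into′ v pv with f (suc v) ≟ f zero
  ... | yes e with inj (suc v) zero pv p0 e
  ...   | ()
  into′ v pv | no _ rewrite into (suc v) pv = refl

count≤1 : ∀ {k} (p : Fin k → Bool) → (∀ v w → p v ≡ true → p w ≡ true → v ≡ w) → count p ≤ 1
count≤1 p same = count-inj p (λ (_ : Fin 1) → true) (λ _ → zero) (λ _ _ → refl)
                   (λ v w pv pw _ → same v w pv pw)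

A : (F : Graph) → Fin (n F) → Fin (n F) → ℕ
A F u v = ind (adj F u v)

deg : (F : Graph) → (Fin (n F) → ℕ) → Fin (n F) → ℕ
deg F y u = sum (λ v → y v * A F u v)

pairs : (F : Graph) → (x y : Fin (n F) → ℕ) → ℕ
pairs F x y = sum (λ u → x u * deg F y u)

pairs-sym : (F : Graph) (x y : Fin (n F) → ℕ) → pairs F x y ≡ pairs F y x
pairs-sym F x y = begin
    sum (λ u → x u * sum (λ v → y v * A F u v))
  ≡⟨ sum-cong-≗ (λ u → *-distribˡ-sum (x u) (λ v → y v * A F u v)) ⟩
    sum (λ u → sum (λ v → x u * (y v * A F u v)))
  ≡⟨ ∑-comm (λ u v → x u * (y v * A F u v)) ⟩
    sum (λ v → sum (λ u → x u * (y v * A F u v)))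
  ≡⟨ sum-cong-≗ (λ v → sum-cong-≗ (λ u → reorder (x u) (y v) (Graph.sym F u v))) ⟩
    sum (λ v → sum (λ u → y v * (x u * A F v u)))
  ≡⟨ sum-cong-≗ (λ v → sym (*-distribˡ-sum (y v) (λ u → x u * A F v u))) ⟩
    sum (λ v → y v * sum (λ u → x u * A F v u)) ∎
  where
  open ≡-Reasoning
  reorder : ∀ {u v} a b → adj F u v ≡ adj F v u → a * (b * A F u v) ≡ b * (a * A F v u)
  reorder {u} {v} a b e = trans (sym (*-assoc a b _))
    (trans (cong₂ _*_ (*-comm a b) (cong ind e)) (*-assoc b a _))

pairs-+ˡ : (F : Graph) (x x′ y : Fin (n F) → ℕ) →
           pairs F (λ u → x u + x′ u) y ≡ pairs F x y + pairs F x′ y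
pairs-+ˡ F x x′ y = trans (sum-cong-≗ (λ u → *-distribʳ-+ (deg F y u) (x u) (x′ u)))
                         (∑-distrib-+ (λ u → x u * deg F y u) (λ u → x′ u * deg F y u))

pairs-+ʳ : (F : Graph) (x y y′ : Fin (n F) → ℕ) →
           pairs F x (λ v → y v + y′ v) ≡ pairs F x y + pairs F x y′
pairs-+ʳ F x y y′ = begin
    pairs F x (λ v → y v + y′ v)
  ≡⟨ pairs-sym F x (λ v → y v + y′ v) ⟩
    pairs F (λ v → y v + y′ v) x
  ≡⟨ pairs-+ˡ F y y′ x ⟩
    pairs F y x + pairs F y′ x
  ≡⟨ cong₂ _+_ (pairs-sym F y x) (pairs-sym F y′ x) ⟩
    pairs F x y + pairs F x y′ ∎
  where open ≡-Reasoning

pairs-cong : (F : Graph) {x x′ y y′ : Fin (n F) → ℕ} →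
             (∀ u → x u ≡ x′ u) → (∀ v → y v ≡ y′ v) → pairs F x y ≡ pairs F x′ y′
pairs-cong F ex ey = sum-cong-≗ (λ u → cong₂ _*_ (ex u) (sum-cong-≗ (λ v → cong (_* A F u v) (ey v))))

deg-count : (F : Graph) (Y : Fin (n F) → Bool) (u : Fin (n F)) →
            deg F (𝟙 Y) u ≡ count (λ w → Y w ∧ adj F u w)
deg-count F Y u = sum-cong-≗ (λ w → sym (ind-∧ (Y w) (adj F u w)))

pairs-≤ : (F : Graph) (X : Fin (n F) → Bool) (y : Fin (n F) → ℕ) (d : ℕ) →
          (∀ u → X u ≡ true → deg F y u ≤ d) → pairs F (𝟙 X) y ≤ d * count X
pairs-≤ F X y d deg≤ = begin
    pairs F (𝟙 X) y
  ≤⟨ sum-mono termwise ⟩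
    sum (λ u → 𝟙 X u * d)
  ≡⟨ sum-cong-≗ (λ u → *-comm (𝟙 X u) d) ⟩
    sum (λ u → d * 𝟙 X u)
  ≡⟨ sym (*-distribˡ-sum d (𝟙 X)) ⟩
    d * count X ∎
  where
  open ≤-Reasoning
  termwise : ∀ u → 𝟙 X u * deg F y u ≤ 𝟙 X u * d
  termwise u with X u in Xu
  ... | false = z≤n
  ... | true  = *-monoʳ-≤ 1 (deg≤ u Xu)

pairs-trivial : (F : Graph) (S : Fin (n F) → Bool) →
                (∀ u v → S u ≡ true → S v ≡ true → u ≡ v) → pairs F (𝟙 S) (𝟙 S) ≡ 0
pairs-trivial F S same = n≤0⇒n≡0 (pairs-≤ F S (𝟙 S) 0 no-neighbour)
  where
  no-edge : ∀ u → S u ≡ true → ∀ w → 𝟙 S w * A F u w ≤ 0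
  no-edge u Su w with S w in Sw
  ... | false = z≤n
  ... | true with same u w Su Sw
  ...   | refl rewrite irrefl F u = z≤n
  no-neighbour : ∀ u → S u ≡ true → deg F (𝟙 S) u ≤ 0
  no-neighbour u Su = ≤-trans (sum-mono (no-edge u Su)) (≤-reflexive (sum-replicate-zero (n F)))

<ᵇ-exactly-one : ∀ a b → a ≢ b → ind (a <ᵇ b) + ind (b <ᵇ a) ≡ 1
<ᵇ-exactly-one zero    zero    a≢b = contradiction refl a≢b
<ᵇ-exactly-one zero    (suc b) a≢b = refl
<ᵇ-exactly-one (suc a) zero    a≢b = refl
<ᵇ-exactly-one (suc a) (suc b) a≢b = <ᵇ-exactly-one a b (λ e → a≢b (cong suc e))

A-orientations : (F : Graph) (u v : Fin (n F)) →
  A F u v ≡ ind (adj F u v ∧ (toℕ u <ᵇ toℕ v)) + ind (adj F v u ∧ (toℕ v <ᵇ toℕ u))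
A-orientations F u v rewrite Graph.sym F v u with adj F u v in uv
... | false = refl
... | true  = sym (<ᵇ-exactly-one (toℕ u) (toℕ v) u≢v)
  where
  u≢v : toℕ u ≢ toℕ v
  u≢v e with toℕ-injective e
  ... | refl = case trans (sym uv) (irrefl F u) of λ ()

handshake : (F : Graph) → 2 * ∣E∣ F ≡ sum (λ u → sum (λ v → A F u v))
handshake F = begin
    2 * ∣E∣ F
  ≡⟨ cong (2 *_) E≡ ⟩
    E + (E + 0)
  ≡⟨ cong (E +_) (trans (+-identityʳ E) (∑-comm forward)) ⟩
    E + sum (λ u → sum (λ v → forward v u))
  ≡⟨ sym (∑-distrib-+ (λ u → sum (forward u)) (λ u → sum (λ v → forward v u))) ⟩
    sum (λ u → sum (forward u) + sum (λ v → forward v u))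
  ≡⟨ sum-cong-≗ (λ u → sym (∑-distrib-+ (forward u) (λ v → forward v u))) ⟩
    sum (λ u → sum (λ v → forward u v + forward v u))
  ≡⟨ sum-cong-≗ (λ u → sum-cong-≗ (λ v → sym (A-orientations F u v))) ⟩
    sum (λ u → sum (λ v → A F u v)) ∎
  where
  open ≡-Reasoning
  forward : Fin (n F) → Fin (n F) → ℕ
  forward u v = ind (adj F u v ∧ (toℕ u <ᵇ toℕ v))
  E = sum (λ u → sum (forward u))
  E≡ : ∣E∣ F ≡ E
  E≡ = trans (listSum-allFin (λ u → List.sum (map (forward u) (allFin (n F)))))
             (sum-cong-≗ (λ u → listSum-allFin (forward u)))

pairs-all : (F : Graph) → pairs F (λ _ → 1) (λ _ → 1) ≡ ∣E∣ F + ∣E∣ F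
pairs-all F = begin
    sum (λ u → 1 * sum (λ v → 1 * A F u v))
  ≡⟨ sum-cong-≗ (λ u → trans (*-identityˡ _) (sum-cong-≗ (λ v → *-identityˡ (A F u v)))) ⟩
    sum (λ u → sum (λ v → A F u v))
  ≡⟨ sym (handshake F) ⟩
    2 * ∣E∣ F
  ≡⟨ cong (∣E∣ F +_) (+-identityʳ (∣E∣ F)) ⟩
    ∣E∣ F + ∣E∣ F ∎
  where open ≡-Reasoning

record Enumeration {k : ℕ} (p : Fin k → Bool) : Set where
  field
    size           : ℕ
    elem           : Fin size → Fin k
    elem-injective : ∀ i j → elem i ≡ elem j → i ≡ j
    elem-∈         : ∀ i → p (elem i) ≡ true
    reindex        : ∀ (g : Fin k → ℕ) → sum (λ i → g (elem i)) ≡ sum (λ b → 𝟙 p b * g b)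

enumerate : ∀ {k} (p : Fin k → Bool) → Enumeration p
enumerate {zero} p = record
  { size = 0 ; elem = λ () ; elem-injective = λ () ; elem-∈ = λ () ; reindex = λ g → refl }
enumerate {suc k} p with enumerate (λ b → p (suc b)) | p zero in p0
... | E | false = record
  { size           = size
  ; elem           = λ i → suc (elem i)
  ; elem-injective = λ i j e → elem-injective i j (suc-injective e)
  ; elem-∈         = elem-∈
  ; reindex        = λ g → trans (reindex (λ b → g (suc b)))
                                 (cong (λ c → ind c * g zero + sum (λ b → 𝟙 p (suc b) * g (suc b)))
                                       (sym p0))
  }
  where open Enumeration E
... | E | true = record
  { size = suc size ; elem = elem′ ; elem-injective = injective′ ; elem-∈ = ∈′
  ; reindex = λ g → cong₂ _+_ (trans (sym (+-identityʳ (g zero))) (cong (λ c → ind c * g zero) (sym p0)))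
                              (reindex (λ b → g (suc b)))
  }
  where
  open Enumeration E
  elem′ : Fin (suc size) → Fin (suc k)
  elem′ zero    = zero
  elem′ (suc i) = suc (elem i)
  injective′ : ∀ i j → elem′ i ≡ elem′ j → i ≡ j
  injective′ zero    zero    e = refl
  injective′ (suc i) (suc j) e = cong suc (elem-injective i j (suc-injective e))
  ∈′ : ∀ i → p (elem′ i) ≡ true
  ∈′ zero    = p0
  ∈′ (suc i) = elem-∈ i

module Induced (F : Graph) (p : Fin (n F) → Bool) where
  open Enumeration (enumerate p)

  graph : Graph
  graph = record
    { n = size ; adj = λ i j → adj F (elem i) (elem j)
    ; sym = λ i j → Graph.sym F (elem i) (elem j) ; irrefl = λ i → irrefl F (elem i) }

  size≡ : ∣V∣ graph ≡ count p
  size≡ = trans (sym (sum-const1 size))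
                (trans (reindex (λ _ → 1)) (sum-cong-≗ (λ b → *-identityʳ (𝟙 p b))))

  handshake≡ : 2 * ∣E∣ graph ≡ pairs F (𝟙 p) (𝟙 p)
  handshake≡ = begin
      2 * ∣E∣ graph
    ≡⟨ handshake graph ⟩
      sum (λ i → sum (λ j → A F (elem i) (elem j)))
    ≡⟨ sum-cong-≗ (λ i → reindex (A F (elem i))) ⟩
      sum (λ i → deg F (𝟙 p) (elem i))
    ≡⟨ reindex (deg F (𝟙 p)) ⟩
      pairs F (𝟙 p) (𝟙 p) ∎
    where open ≡-Reasoning

  embedding : {S : Fin (n F) → Set} → (∀ b → p b ≡ true → S b) → SubgraphIn graph F S
  embedding p⊆S = elem , elem-injective , (λ i j e → e) , (λ i → p⊆S (elem i) (elem-∈ i))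

below-average : ∀ {k} (β : ℕ) (p : Fin k → Bool) (d : Fin k → ℕ) →
  sum (λ b → 𝟙 p b * d b) ≤ β * count p →
  ∀ a₀ → p a₀ ≡ true → ∃ λ a → p a ≡ true × d a ≤ β
below-average β p d total≤ a₀ pa₀
  with any? (λ a → (p a Bool.≟ true) ×-dec (d a ≤? β))
... | yes found = found
... | no none = contradiction total≤ (<⇒≱ total>)
  where
  big : ∀ b → 𝟙 p b * suc β ≤ 𝟙 p b * d b
  big b with p b in pb
  ... | false = z≤n
  ... | true  = *-monoʳ-≤ 1 (≰⇒> (λ d≤β → none (b , pb , d≤β)))
  total> : β * count p < sum (λ b → 𝟙 p b * d b)
  total> = begin-strict
      β * count p
    <⟨ m<n+m (β * count p) (member≤count p a₀ pa₀) ⟩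
      suc β * count p
    ≡⟨ *-distribˡ-sum (suc β) (𝟙 p) ⟩
      sum (λ b → suc β * 𝟙 p b)
    ≡⟨ sum-cong-≗ (λ b → *-comm (suc β) (𝟙 p b)) ⟩
      sum (λ b → 𝟙 p b * suc β)
    ≤⟨ sum-mono big ⟩
      sum (λ b → 𝟙 p b * d b) ∎
    where open ≤-Reasoning

mad-mono : (F : Graph) {S T : Fin (n F) → Set} (k : ℕ) → (∀ b → T b → S b) →
           MadAtMost F S k → MadAtMost F T k
mad-mono F k T⊆S mad H (f , f-inj , f-adj , f∈T) = mad H (f , f-inj , f-adj , λ u → T⊆S (f u) (f∈T u))

sparse-vertex : (F : Graph) (S : Fin (n F) → Set) (β : ℕ) → MadAtMost F S β →
  (p : Fin (n F) → Bool) → (∀ b → p b ≡ true → S b) →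
  ∀ a₀ → p a₀ ≡ true → ∃ λ a → p a ≡ true × deg F (𝟙 p) a ≤ β
sparse-vertex F S β mad p p⊆S = below-average β p (deg F (𝟙 p)) total≤
  where
  open Induced F p
  total≤ : pairs F (𝟙 p) (𝟙 p) ≤ β * count p
  total≤ = subst₂ _≤_ handshake≡ (cong (β *_) size≡) (mad graph (embedding p⊆S))

-- Φ b k = k^(b·k); the inequality 2^e ≤ Φ b k says e ≤ b·k·log k.
Φ : ℕ → ℕ → ℕ
Φ b k = k ^ (b * k)

Φ-positive : ∀ b k → 1 ≤ Φ b k
Φ-positive b zero    rewrite *-zeroʳ b = ≤-refl
Φ-positive b (suc k) = m^n>0 (suc k) (b * suc k)

*-distrib-^ : ∀ x y e → (x * y) ^ e ≡ x ^ e * y ^ e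
*-distrib-^ x y zero    = refl
*-distrib-^ x y (suc e) = begin
    x * y * (x * y) ^ e
  ≡⟨ cong (x * y *_) (*-distrib-^ x y e) ⟩
    x * y * (x ^ e * y ^ e)
  ≡⟨ *-assoc x y _ ⟩
    x * (y * (x ^ e * y ^ e))
  ≡⟨ cong (x *_) (x∙yz≈y∙xz y (x ^ e) (y ^ e)) ⟩
    x * (x ^ e * (y * y ^ e))
  ≡⟨ sym (*-assoc x (x ^ e) _) ⟩
    x * x ^ e * (y * y ^ e) ∎
  where
  open ≡-Reasoning

-- For k ≤ l and c ≤ b·k:  c + b·k·log k + b·l·log l ≤ b·(k+l)·log(k+l),
-- because 2k ≤ k + l.
Φ-merge-ordered : ∀ b k l c → k ≤ l → c ≤ b * k → 2 ^ c * (Φ b k * Φ b l) ≤ Φ b (k + l)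
Φ-merge-ordered b k l c k≤l c≤bk = begin
    2 ^ c * (Φ b k * Φ b l)
  ≤⟨ *-monoˡ-≤ (Φ b k * Φ b l) (^-monoʳ-≤ 2 c≤bk) ⟩
    2 ^ (b * k) * (k ^ (b * k) * Φ b l)
  ≡⟨ sym (*-assoc (2 ^ (b * k)) _ _) ⟩
    2 ^ (b * k) * k ^ (b * k) * Φ b l
  ≡⟨ cong (_* Φ b l) (sym (*-distrib-^ 2 k (b * k))) ⟩
    (2 * k) ^ (b * k) * l ^ (b * l)
  ≤⟨ *-mono-≤ (^-monoˡ-≤ (b * k) 2k≤k+l) (^-monoˡ-≤ (b * l) (m≤n+m l k)) ⟩
    (k + l) ^ (b * k) * (k + l) ^ (b * l)
  ≡⟨ sym (^-distribˡ-+-* (k + l) (b * k) (b * l)) ⟩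
    (k + l) ^ (b * k + b * l)
  ≡⟨ cong ((k + l) ^_) (sym (*-distribˡ-+ b k l)) ⟩
    Φ b (k + l) ∎
  where
  open ≤-Reasoning
  2k≤k+l : 2 * k ≤ k + l
  2k≤k+l = subst (_≤ k + l) (cong (k +_) (sym (+-identityʳ k))) (+-monoʳ-≤ k k≤l)

Φ-merge : ∀ b k l c → c ≤ b * k → c ≤ b * l → 2 ^ c * (Φ b k * Φ b l) ≤ Φ b (k + l)
Φ-merge b k l c c≤bk c≤bl with ≤-total k l
... | inj₁ k≤l = Φ-merge-ordered b k l c k≤l c≤bk
... | inj₂ l≤k rewrite *-comm (Φ b k) (Φ b l) | +-comm k l = Φ-merge-ordered b l k c l≤k c≤bl

-- The inductive step of the edge bound: parts of sizes k and l carrying x and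
-- y edges, joined by c ≤ b·min(k, l) edges.
Φ-step : ∀ b k l c x y → 2 ^ x ≤ Φ b k → 2 ^ y ≤ Φ b l → c ≤ b * k → c ≤ b * l →
         2 ^ (x + y + c) ≤ Φ b (k + l)
Φ-step b k l c x y hx hy c≤bk c≤bl = begin
    2 ^ (x + y + c)
  ≡⟨ ^-distribˡ-+-* 2 (x + y) c ⟩
    2 ^ (x + y) * 2 ^ c
  ≡⟨ *-comm (2 ^ (x + y)) (2 ^ c) ⟩
    2 ^ c * 2 ^ (x + y)
  ≡⟨ cong (2 ^ c *_) (^-distribˡ-+-* 2 x y) ⟩
    2 ^ c * (2 ^ x * 2 ^ y)
  ≤⟨ *-monoʳ-≤ (2 ^ c) (*-mono-≤ hx hy) ⟩
    2 ^ c * (Φ b k * Φ b l)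
  ≤⟨ Φ-merge b k l c c≤bk c≤bl ⟩
    Φ b (k + l) ∎
  where open ≤-Reasoning

Φ-halve : ∀ b k e → 2 ^ (e + e) ≤ Φ (2 * b) k → 2 ^ e ≤ Φ b k
Φ-halve b k e h with 2 ^ e ≤? Φ b k
... | yes ≤Φ = ≤Φ
... | no  ≰Φ = contradiction h (<⇒≱ (subst₂ _<_ (sym Φ2b≡) (sym (^-distribˡ-+-* 2 e e))
                                        (*-mono-< (≰⇒> ≰Φ) (≰⇒> ≰Φ))))
  where
  Φ2b≡ : Φ (2 * b) k ≡ Φ b k * Φ b k
  Φ2b≡ = trans (cong (k ^_) (trans (*-assoc 2 b k) (cong (b * k +_) (+-identityʳ (b * k)))))
               (^-distribˡ-+-* k (b * k) (b * k))

-- If c ≤ b·k and c ≤ l then c ≤ b·l: either b = 0 and c = 0, or l ≤ b·l.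
≤-transfer : ∀ b {c} k l → c ≤ b * k → c ≤ l → c ≤ b * l
≤-transfer zero    k l c≤0 c≤l = c≤0
≤-transfer (suc b) k l c≤bk c≤l = ≤-trans c≤l (m≤m+n l (b * l))

+-double-≤ : ∀ b k {c} → c ≤ b * k → c + c ≤ 2 * b * k
+-double-≤ b k {c} c≤bk = subst (c + c ≤_) (trans (cong (b * k +_) (sym (+-identityʳ (b * k)))) (sym (*-assoc 2 b k)))
                            (+-mono-≤ c≤bk c≤bk)

module ProductSubgraph {m : ℕ} (Gs : Fin m → Graph) (G : Graph) (φ : Fin (n G) → ProdV Gs)
                       (φ-sub : IsProdSubgraph Gs G φ) where

  φ-injective : ∀ u v → (∀ i → φ u i ≡ φ v i) → u ≡ v
  φ-injective = proj₁ φ-sub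

  edge-direction : ∀ {u v} i → adj G u v ≡ true → φ u i ≢ φ v i →
    adj (Gs i) (φ u i) (φ v i) ≡ true × (∀ t → t ≢ i → φ u t ≡ φ v t)
  edge-direction {u} {v} i uv differ with proj₂ φ-sub u v uv
  ... | j , adj-j , same-off-j with i ≟ j
  ...   | yes refl = adj-j , same-off-j
  ...   | no  i≢j  = contradiction (same-off-j i i≢j) differ

  agree-off : ∀ {u v} i → (∀ t → t ≢ i → φ u t ≡ φ v t) → φ u i ≡ φ v i → u ≡ v
  agree-off {u} {v} i off at = φ-injective u v coordinate
    where
    coordinate : ∀ t → φ u t ≡ φ v t
    coordinate t with t ≟ i
    ... | yes refl = at
    ... | no  t≢i  = off t t≢i

  VSet : Set
  VSet = Fin (n G) → Bool

  e₂ : VSet → ℕ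
  e₂ S = pairs G (𝟙 S) (𝟙 S)

  proj : VSet → (i : Fin m) → Fin (n (Gs i)) → Bool
  proj S i b = does (any? (λ w → (S w Bool.≟ true) ×-dec (φ w i ≟ b)))

  proj-∈ : ∀ S i w → S w ≡ true → proj S i (φ w i) ≡ true
  proj-∈ S i w Sw = dec-true (any? _) (w , Sw , refl)

  proj-witness : ∀ S i b → proj S i b ≡ true → ∃ λ w → S w ≡ true × φ w i ≡ b
  proj-witness S i b = from-does (any? _)

  proj-⊆ : ∀ S i b → proj S i b ≡ true → ProjSet Gs G φ i b
  proj-⊆ S i b πb with proj-witness S i b πb
  ... | w , _ , φw≡b = w , φw≡b

  module Split (S : VSet) (i : Fin m) (a : Fin (n (Gs i))) where

    fibre rest : VSet
    fibre w = S w ∧ does (φ w i ≟ a)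
    rest  w = S w ∧ not (does (φ w i ≟ a))

    ∈fibre : ∀ {w} → fibre w ≡ true → S w ≡ true × φ w i ≡ a
    ∈fibre {w} h = map₂ (from-does (φ w i ≟ a)) (∧-true (S w) _ h)

    ∈rest : ∀ {w} → rest w ≡ true → S w ≡ true × φ w i ≢ a
    ∈rest {w} h = map₂ (from-not-does (φ w i ≟ a)) (∧-true (S w) _ h)

    fibre-intro : ∀ {w} → S w ≡ true → φ w i ≡ a → fibre w ≡ true
    fibre-intro {w} Sw e = cong₂ _∧_ Sw (dec-true (φ w i ≟ a) e)

    rest-intro : ∀ {w} → S w ≡ true → φ w i ≢ a → rest w ≡ true
    rest-intro {w} Sw ne = cong₂ _∧_ Sw (cong not (dec-false (φ w i ≟ a) ne))

    𝟙-split : ∀ w → 𝟙 S w ≡ 𝟙 fibre w + 𝟙 rest w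
    𝟙-split w = ind-split (S w) (does (φ w i ≟ a))

    count-split : count S ≡ count fibre + count rest
    count-split = trans (sum-cong-≗ 𝟙-split) (∑-distrib-+ (𝟙 fibre) (𝟙 rest))

    crossing : ℕ
    crossing = pairs G (𝟙 fibre) (𝟙 rest)

    e₂-split : e₂ S ≡ e₂ fibre + e₂ rest + (crossing + crossing)
    e₂-split = begin
        e₂ S
      ≡⟨ pairs-cong G 𝟙-split 𝟙-split ⟩
        pairs G (λ w → X w + Y w) (λ w → X w + Y w)
      ≡⟨ pairs-+ˡ G X Y (λ w → X w + Y w) ⟩
        pairs G X (λ w → X w + Y w) + pairs G Y (λ w → X w + Y w)
      ≡⟨ cong₂ _+_ (pairs-+ʳ G X X Y) (pairs-+ʳ G Y X Y) ⟩
        (pairs G X X + C) + (pairs G Y X + pairs G Y Y)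
      ≡⟨ cong (λ c → (pairs G X X + C) + (c + pairs G Y Y)) (pairs-sym G Y X) ⟩
        (pairs G X X + C) + (C + pairs G Y Y)
      ≡⟨ regroup (pairs G X X) C (pairs G Y Y) ⟩
        pairs G X X + pairs G Y Y + (C + C) ∎
      where
      open ≡-Reasoning
      X = 𝟙 fibre
      Y = 𝟙 rest
      C = crossing
      regroup : ∀ p c q → (p + c) + (c + q) ≡ p + q + (c + c)
      regroup = solve-∀

    -- A vertex x of the fibre has at most as many neighbours in the rest as a
    -- has in π_i(S): such a neighbour w differs from x only in coordinate i,
    -- where φ w i is a neighbour of a in π_i(S) that determines w.
    fibre-to-rest : ∀ x → fibre x ≡ true → deg G (𝟙 rest) x ≤ deg (Gs i) (𝟙 (proj S i)) a
    fibre-to-rest x x∈F = subst₂ _≤_ (sym (deg-count G rest x)) (sym (deg-count (Gs i) (proj S i) a))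
      (count-inj (λ w → rest w ∧ adj G x w) (λ b → proj S i b ∧ adj (Gs i) a b)
                 (λ w → φ w i) into injective)
      where
      φxi≡a : φ x i ≡ a
      φxi≡a = proj₂ (∈fibre x∈F)
      i-edge : ∀ {w} → (rest w ∧ adj G x w) ≡ true →
               adj (Gs i) (φ x i) (φ w i) ≡ true × (∀ t → t ≢ i → φ x t ≡ φ w t)
      i-edge {w} h with ∧-true _ _ h
      ... | w∈R , xw = edge-direction i xw (λ e → proj₂ (∈rest w∈R) (trans (sym e) φxi≡a))
      into : ∀ w → (rest w ∧ adj G x w) ≡ true → (proj S i (φ w i) ∧ adj (Gs i) a (φ w i)) ≡ true
      into w h = cong₂ _∧_ (proj-∈ S i w (proj₁ (∈rest (proj₁ (∧-true _ _ h)))))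
                           (subst (λ c → adj (Gs i) c (φ w i) ≡ true) φxi≡a (proj₁ (i-edge h)))
      injective : ∀ w w′ → (rest w ∧ adj G x w) ≡ true → (rest w′ ∧ adj G x w′) ≡ true →
                  φ w i ≡ φ w′ i → w ≡ w′
      injective w w′ h h′ =
        agree-off i (λ t t≢i → trans (sym (proj₂ (i-edge h) t t≢i)) (proj₂ (i-edge h′) t t≢i))

    -- A vertex w of the rest has at most one neighbour in the fibre: such a
    -- neighbour differs from w only in coordinate i, where it takes the value a.
    rest-to-fibre : ∀ w → rest w ≡ true → deg G (𝟙 fibre) w ≤ 1
    rest-to-fibre w w∈R = subst (_≤ 1) (sym (deg-count G fibre w))
      (count≤1 (λ x → fibre x ∧ adj G w x) unique)
      where
      i-edge : ∀ {x} → (fibre x ∧ adj G w x) ≡ true → φ x i ≡ a × (∀ t → t ≢ i → φ w t ≡ φ x t)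
      i-edge {x} h with ∧-true _ _ h
      ... | x∈F , wx = proj₂ (∈fibre x∈F) ,
                       proj₂ (edge-direction i wx (λ e → proj₂ (∈rest w∈R) (trans e (proj₂ (∈fibre x∈F)))))
      unique : ∀ x x′ → (fibre x ∧ adj G w x) ≡ true → (fibre x′ ∧ adj G w x′) ≡ true → x ≡ x′
      unique x x′ h h′ =
        agree-off i (λ t t≢i → trans (sym (proj₂ (i-edge h) t t≢i)) (proj₂ (i-edge h′) t t≢i))
                    (trans (proj₁ (i-edge h)) (sym (proj₁ (i-edge h′))))

    crossing≤fibre : ∀ d → deg (Gs i) (𝟙 (proj S i)) a ≤ d → crossing ≤ d * count fibre
    crossing≤fibre d deg≤ = pairs-≤ G fibre (𝟙 rest) d (λ x x∈F → ≤-trans (fibre-to-rest x x∈F) deg≤)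

    crossing≤rest : crossing ≤ count rest
    crossing≤rest = subst₂ _≤_ (pairs-sym G (𝟙 rest) (𝟙 fibre)) (*-identityˡ (count rest))
                              (pairs-≤ G rest (𝟙 fibre) 1 rest-to-fibre)

  Divided : VSet → Set
  Divided S = ∃ λ u → ∃ λ v → S u ≡ true × S v ≡ true × ∃ λ i → φ u i ≢ φ v i

  divided? : ∀ S → Dec (Divided S)
  divided? S = any? λ u → any? λ v → (S u Bool.≟ true) ×-dec (S v Bool.≟ true) ×-dec
                                     any? (λ i → ¬? (φ u i ≟ φ v i))

  undivided-coincide : ∀ S → ¬ Divided S → ∀ u v → S u ≡ true → S v ≡ true → u ≡ v
  undivided-coincide S undivided u v Su Sv = φ-injective u v λ i →
    decidable-stable (φ u i ≟ φ v i) (λ differ → undivided (u , v , Su , Sv , i , differ))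

  module EdgeBound (β₀ : ℕ) (mad : ∀ i → MadAtMost (Gs i) (ProjSet Gs G φ i) β₀) where

    Bounded : VSet → Set
    Bounded S = 2 ^ e₂ S ≤ Φ (2 * β₀) (count S)

    undivided-bounded : ∀ S → ¬ Divided S → Bounded S
    undivided-bounded S undivided rewrite pairs-trivial G S (undivided-coincide S undivided) =
      Φ-positive (2 * β₀) (count S)

    -- Split a divided S along a value a of π_i(S) with at most β₀ neighbours
    -- in π_i(S); both parts are nonempty, so induction applies to them, and
    -- the crossing is at most β₀·min(∣fibre∣, ∣rest∣).
    divided-bounded : ∀ S → Divided S → (∀ {S′} → count S′ < count S → Bounded S′) → Bounded S
    divided-bounded S (u , v , Su , Sv , i , differ) ih
      with sparse-vertex (Gs i) (ProjSet Gs G φ i) β₀ (mad i) (proj S i) (proj-⊆ S i)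
                         (φ u i) (proj-∈ S i u Su)
    ... | a , a∈π , deg≤β₀ =
      subst₂ (λ e k → 2 ^ e ≤ Φ (2 * β₀) k) (sym e₂-split) (sym count-split)
        (Φ-step (2 * β₀) (count fibre) (count rest) (crossing + crossing) (e₂ fibre) (e₂ rest)
                (ih fibre<S) (ih rest<S)
                (+-double-≤ β₀ (count fibre) crossing≤β₀fibre)
                (+-double-≤ β₀ (count rest) crossing≤β₀rest))
      where
      open Split S i a
      crossing≤β₀fibre : crossing ≤ β₀ * count fibre
      crossing≤β₀fibre = crossing≤fibre β₀ deg≤β₀
      crossing≤β₀rest : crossing ≤ β₀ * count rest
      crossing≤β₀rest = ≤-transfer β₀ (count fibre) (count rest) crossing≤β₀fibre crossing≤rest
      fibre-nonempty : ∃ λ w → fibre w ≡ true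
      fibre-nonempty with proj-witness S i a a∈π
      ... | w , Sw , φwi≡a = w , fibre-intro Sw φwi≡a
      rest-nonempty : ∃ λ w → rest w ≡ true
      rest-nonempty with φ u i ≟ a
      ... | yes φui≡a = v , rest-intro Sv (λ φvi≡a → differ (trans φui≡a (sym φvi≡a)))
      ... | no  φui≢a = u , rest-intro Su φui≢a
      fibre<S : count fibre < count S
      fibre<S = subst (count fibre <_) (sym count-split)
                      (m<m+n (count fibre) (member≤count rest _ (proj₂ rest-nonempty)))
      rest<S : count rest < count S
      rest<S = subst (count rest <_) (sym count-split)
                     (m<n+m (count rest) (member≤count fibre _ (proj₂ fibre-nonempty)))

    bounded : ∀ S → Bounded S
    bounded = All.wfRec (On.wellFounded count <-wellFounded) _ Bounded inductive-step
      where
      inductive-step : ∀ S → (∀ {S′} → count S′ < count S → Bounded S′) → Bounded S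
      inductive-step S ih with divided? S
      ... | yes divided = divided-bounded S divided ih
      ... | no  undivided = undivided-bounded S undivided

theorem4p1 : (m : ℕ) (Gs : Fin m → Graph) → (∀ i → Connected (Gs i)) →
             (G : Graph) (φ : Fin (n G) → ProdV Gs) → IsProdSubgraph Gs G φ →
             1 ≤ ∣V∣ G →
             (β β₀ : ℕ) → IsCeilMaxMad Gs (AllV Gs) β →
             IsCeilMaxMad Gs (ProjSet Gs G φ) β₀ →
             (2 ^ ∣E∣ G ≤ ∣V∣ G ^ (β₀ * ∣V∣ G)) × (∣V∣ G ^ β₀ ≤ ∣V∣ G ^ β)
theorem4p1 m Gs _ G φ φ-sub 1≤∣V∣ β β₀ (madβ , _) (madβ₀ , least-β₀) = edge-bound , β₀≤β-power
  where
  open ProductSubgraph Gs G φ φ-sub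
  open EdgeBound β₀ madβ₀
  edge-bound : 2 ^ ∣E∣ G ≤ ∣V∣ G ^ (β₀ * ∣V∣ G)
  edge-bound = Φ-halve β₀ (n G) (∣E∣ G)
    (subst₂ (λ e k → 2 ^ e ≤ Φ (2 * β₀) k) (pairs-all G) (sum-const1 (n G)) (bounded (λ _ → true)))
  -- β₀ ≤ β since β bounds the mad of each G_i, hence of each π_i(G).
  β₀≤β-power : ∣V∣ G ^ β₀ ≤ ∣V∣ G ^ β
  β₀≤β-power = ^-monoʳ-≤ (n G) {{>-nonZero 1≤∣V∣}}
    (least-β₀ β (λ i → mad-mono (Gs i) {T = ProjSet Gs G φ i} β (λ _ _ → _) (madβ i)))
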